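{- Let $X$ be a graph and for $i\geq 1$ let $t_i$ be the number of triangles in $\gamma^{i-1}(X)$. Then $t_i=2^{i-1}t_1$ for all $i\geq 1$.
   Context: All graphs are finite, without loops or multiple edges. For a graph $X$ with $m$ edges, orient each edge arbitrarily and label the oriented edges $e_1,\dots,e_m$; put $e_{m+i}=e_i^{ -1}$ ($e_i$ reversed), and write $s(e),t(e)$ for the starting and terminal vertex of an oriented edge $e$. The edge adjacency matrix $M$ is the $2m\times 2m$ matrix with $M_{ij}=1$ if $t(e_i)=s(e_j)$ and $s(e_i)\neq t(e_j)$, and $0$ otherwise. The symmetric edge graph $\gamma(X)$ is the graph on the $2m$ vertices $e_1,\dots,e_{2m}$ with adjacency matrix $M+M^T$. Equivalently, the vertices of $\gamma(X)$ are the ordered pairs $(u,v)$ with $uv\in E(X)$, and $(u,v)\sim(x,y)$ iff ($v=x$ and $y\neq u$) or ($y=u$ and $x\neq v$). Iterates: $\gamma^0(X)=X$ and $\gamma^k(X)=\gamma(\gamma^{k-1}(X))$ for $k\geq 1$. -}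

module Defs where

open import Data.Nat using (ℕ; _+_)
open import Data.Bool using (Bool; true; false; _∧_; _∨_; not; if_then_else_)
open import Data.Fin using (Fin; _≟_; _<?_)
open import Data.List using (List; []; _∷_; concatMap; length; lookup; map; allFin)
open import Data.Nat.ListAction using (sum)
open import Data.Product using (_×_; _,_)
open import Relation.Nullary.Decidable using (⌊_⌋)
open import Relation.Binary.PropositionalEquality using (_≡_)

record Graph : Set where
  field
    n   : ℕ
    adj : Fin n → Fin n → Bool
open Graph public

IsSimple : Graph → Set
IsSimple X = (∀ u v → adj X u v ≡ adj X v u) × (∀ u → adj X u u ≡ false)

_=ᶠ_ : ∀ {k} → Fin k → Fin k → Bool
u =ᶠ v = ⌊ u ≟ v ⌋

darts : (X : Graph) → List (Fin (n X) × Fin (n X))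
darts X = concatMap (λ u → concatMap (λ v → if adj X u v then (u , v) ∷ [] else [])
                                      (allFin (n X)))
                    (allFin (n X))

γadj : ∀ {k} → Fin k × Fin k → Fin k × Fin k → Bool
γadj (u , v) (x , y) = ((v =ᶠ x) ∧ not (y =ᶠ u)) ∨ ((y =ᶠ u) ∧ not (x =ᶠ v))

γ : Graph → Graph
γ X = record { n = length (darts X)
             ; adj = λ i j → γadj (lookup (darts X) i) (lookup (darts X) j) }

γ^ : ℕ → Graph → Graph
γ^ ℕ.zero X = X
γ^ (ℕ.suc k) X = γ (γ^ k X)

Σᶠ : ∀ {k} → (Fin k → ℕ) → ℕ
Σᶠ {k} f = sum (map f (allFin k))

triangles : Graph → ℕ
triangles X = Σᶠ λ i → Σᶠ λ j → Σᶠ λ k →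
  if ⌊ i <? j ⌋ ∧ ⌊ j <? k ⌋ ∧ adj X i j ∧ adj X j k ∧ adj X i k then 1 else 0

module Submission where

-- Count ordered triangles (triples of pairwise adjacent vertices) instead of triangles:
-- in a simple graph every triangle has 6 orderings. Write an ordered triangle of γ X as three
-- darts (u₁,v₁), (u₂,v₂), (u₃,v₃) of X. Each γ-adjacency says that one dart ends where the other
-- starts; of the 8 ways to orient the three pairs, the 6 non-cyclic ones force some dart to be a
-- loop, so the darts are the arcs of a directed triangle u₁ → u₂ → u₃ → u₁ or u₁ → u₃ → u₂ → u₁.
-- Thus, for fixed tails u₁ u₂ u₃, there are two choices of heads if u₁u₂u₃ is an ordered triangle
-- of X and none otherwise: ordered triangles double under γ, and since γ X is again simple, so do
-- triangles.

open import Defs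
open import Algebra.Properties.CommutativeSemigroup using (x∙yz≈y∙xz)
open import Data.Bool using (Bool; true; false; T; _∧_; _∨_; not; if_then_else_)
open import Data.Bool.Properties using (T-∧; T-∨; ∧-comm; ∧-assoc; ∨-comm; ∧-inverseʳ)
open import Data.Empty using (⊥-elim)
open import Data.Fin using (Fin; zero; suc; _≟_; _<?_)
open import Data.Fin.Patterns using (0F; 1F; 2F; 3F; 4F; 5F)
import Data.Fin.Properties as Fin
open import Data.List using (List; []; _∷_; _++_; concatMap; length; lookup; map; tabulate; allFin)
open import Data.List.Properties using (map-tabulate; map-++)
open import Data.Nat using (ℕ; zero; suc; _+_; _*_; _^_)
open import Data.Nat.ListAction using () renaming (sum to sumˡ)
open import Data.Nat.ListAction.Properties using () renaming (sum-++ to sumˡ-++)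
open import Data.Nat.Properties
  using (+-*-semiring; *-commutativeSemigroup; +-identityʳ; *-identityˡ; *-zeroʳ; *-assoc; *-cancelˡ-≡; ≮⇒≥; <-≤-trans)
open import Data.Product using (_×_; _,_; proj₁; proj₂)
open import Data.Sum as Sum using (_⊎_; inj₁; inj₂)
open import Function using (_∘_; Equivalence)
open import Relation.Nullary using (¬_; yes; no)
open import Relation.Nullary.Decidable using (⌊_⌋; toWitness; fromWitness; fromWitnessFalse)
open import Relation.Binary.PropositionalEquality
open ≡-Reasoning

open import Algebra.Properties.Semiring.Sum +-*-semiring
  using (sum; sum-syntax; sum-cong-≗; ∑-comm; ∑-distrib-+; *-distribˡ-sum; *-distribʳ-sum;
         sum-replicate; sum-replicate-zero)

⟦_⟧ : Bool → ℕ
⟦ b ⟧ = if b then 1 else 0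

⟦∧⟧ : ∀ x y → ⟦ x ∧ y ⟧ ≡ ⟦ x ⟧ * ⟦ y ⟧
⟦∧⟧ true  true  = refl
⟦∧⟧ true  false = refl
⟦∧⟧ false y     = refl

⟦⟧≢0⇒T : ∀ {b} → ⟦ b ⟧ ≢ 0 → T b
⟦⟧≢0⇒T {true}  _  = _
⟦⟧≢0⇒T {false} ≢0 = ≢0 refl

⟦⟧-partition : ∀ {b c d} → (T b → T c ⊎ T d) → (T c → T b) → (T d → T b) → (T c → ¬ T d) →
  ⟦ b ⟧ ≡ ⟦ c ⟧ + ⟦ d ⟧
⟦⟧-partition {true}  {true}  {true}  _     _   _   c∧d = ⊥-elim (c∧d _ _)
⟦⟧-partition {true}  {true}  {false} _     _   _   _   = refl
⟦⟧-partition {true}  {false} {true}  _     _   _   _   = refl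
⟦⟧-partition {true}  {false} {false} b⇒c∨d _   _   _   with b⇒c∨d _
... | inj₁ ()
... | inj₂ ()
⟦⟧-partition {false} {true}  {_}     _     c⇒b _   _   = ⊥-elim (c⇒b _)
⟦⟧-partition {false} {false} {true}  _     _   d⇒b _   = ⊥-elim (d⇒b _)
⟦⟧-partition {false} {false} {false} _     _   _   _   = refl

∧⁺ : ∀ {x y} → T x → T y → T (x ∧ y)
∧⁺ p q = Equivalence.from T-∧ (p , q)

∧⁻ : ∀ {x y} → T (x ∧ y) → T x × T y
∧⁻ = Equivalence.to T-∧

sumˡ-tabulate : ∀ {m} (f : Fin m → ℕ) → sumˡ (tabulate f) ≡ sum f
sumˡ-tabulate {zero}  f = refl
sumˡ-tabulate {suc m} f = cong (f zero +_) (sumˡ-tabulate (f ∘ suc))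

Σᶠ≡sum : ∀ {m} (f : Fin m → ℕ) → Σᶠ f ≡ sum f
Σᶠ≡sum f = trans (cong sumˡ (map-tabulate (λ i → i) f)) (sumˡ-tabulate f)

∑-lookup : ∀ {A : Set} (xs : List A) (h : A → ℕ) → ∑[ i < length xs ] h (lookup xs i) ≡ sumˡ (map h xs)
∑-lookup []       h = refl
∑-lookup (x ∷ xs) h = cong (h x +_) (∑-lookup xs h)

sumˡ-concatMap : ∀ {A B : Set} (h : B → ℕ) (f : A → List B) (xs : List A) →
  sumˡ (map h (concatMap f xs)) ≡ sumˡ (map (λ x → sumˡ (map h (f x))) xs)
sumˡ-concatMap h f []       = refl
sumˡ-concatMap h f (x ∷ xs) = begin
  sumˡ (map h (f x ++ concatMap f xs))               ≡⟨ cong sumˡ (map-++ h (f x) (concatMap f xs)) ⟩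
  sumˡ (map h (f x) ++ map h (concatMap f xs))       ≡⟨ sumˡ-++ (map h (f x)) (map h (concatMap f xs)) ⟩
  sumˡ (map h (f x)) + sumˡ (map h (concatMap f xs)) ≡⟨ cong (sumˡ (map h (f x)) +_) (sumˡ-concatMap h f xs) ⟩
  sumˡ (map h (f x)) + sumˡ (map (λ x → sumˡ (map h (f x))) xs) ∎

∑-δ : ∀ {m} (x : Fin m) b → ∑[ v < m ] ⟦ (v =ᶠ x) ∧ b ⟧ ≡ ⟦ b ⟧
∑-δ {suc m} zero    b = trans (cong (⟦ b ⟧ +_) (sum-replicate-zero m)) (+-identityʳ ⟦ b ⟧)
∑-δ {suc m} (suc x) b = trans (sum-cong-≗ λ v → cong (λ e → ⟦ e ∧ b ⟧) (suc-=ᶠ v x)) (∑-δ x b)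
  where
  suc-=ᶠ : ∀ (v x : Fin m) → (suc v =ᶠ suc x) ≡ (v =ᶠ x)
  suc-=ᶠ v x with v ≟ x
  ... | yes _ = refl
  ... | no _  = refl

∑² : ∀ {m} → (Fin m → Fin m → ℕ) → ℕ
∑² {m} f = ∑[ i < m ] ∑[ j < m ] f i j

∑³ : ∀ {m} → (Fin m → Fin m → Fin m → ℕ) → ℕ
∑³ {m} f = ∑[ i < m ] ∑[ j < m ] ∑[ k < m ] f i j k

∑²-cong : ∀ {m} {f g : Fin m → Fin m → ℕ} → (∀ i j → f i j ≡ g i j) → ∑² f ≡ ∑² g
∑²-cong f≗g = sum-cong-≗ λ i → sum-cong-≗ (f≗g i)

∑³-cong : ∀ {m} {f g : Fin m → Fin m → Fin m → ℕ} → (∀ i j k → f i j k ≡ g i j k) → ∑³ f ≡ ∑³ g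
∑³-cong f≗g = sum-cong-≗ λ i → ∑²-cong (f≗g i)

Σᶠ³≡∑³ : ∀ {m} (f : Fin m → Fin m → Fin m → ℕ) → (Σᶠ λ i → Σᶠ λ j → Σᶠ λ k → f i j k) ≡ ∑³ f
Σᶠ³≡∑³ f = trans (Σᶠ≡sum λ i → Σᶠ λ j → Σᶠ (f i j))
  (sum-cong-≗ λ i → trans (Σᶠ≡sum λ j → Σᶠ (f i j)) (sum-cong-≗ λ j → Σᶠ≡sum (f i j)))

*-distribˡ-∑² : ∀ {m} c (f : Fin m → Fin m → ℕ) → c * ∑² f ≡ ∑² (λ i j → c * f i j)
*-distribˡ-∑² c f = trans (*-distribˡ-sum c (λ i → sum (f i))) (sum-cong-≗ λ i → *-distribˡ-sum c (f i))

*-distribˡ-∑³ : ∀ {m} c (f : Fin m → Fin m → Fin m → ℕ) → c * ∑³ f ≡ ∑³ (λ i j k → c * f i j k)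
*-distribˡ-∑³ c f =
  trans (*-distribˡ-sum c (λ i → ∑² (f i))) (sum-cong-≗ λ i → *-distribˡ-∑² c (f i))

∑³-distrib-+ : ∀ {m} (f g : Fin m → Fin m → Fin m → ℕ) → ∑³ (λ i j k → f i j k + g i j k) ≡ ∑³ f + ∑³ g
∑³-distrib-+ f g =
  trans (sum-cong-≗ λ i → trans (sum-cong-≗ λ j → ∑-distrib-+ (f i j) (g i j))
                                (∑-distrib-+ (λ j → sum (f i j)) (λ j → sum (g i j))))
        (∑-distrib-+ (λ i → ∑² (f i)) (λ i → ∑² (g i)))

∑³-swap₁₂ : ∀ {m} (f : Fin m → Fin m → Fin m → ℕ) → ∑³ (λ i j k → f j i k) ≡ ∑³ f
∑³-swap₁₂ f = ∑-comm (λ i j → sum (f j i))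

∑³-swap₂₃ : ∀ {m} (f : Fin m → Fin m → Fin m → ℕ) → ∑³ (λ i j k → f i k j) ≡ ∑³ f
∑³-swap₂₃ f = sum-cong-≗ λ i → ∑-comm (λ j k → f i k j)

∑³-∑-comm : ∀ {m n} (g : Fin n → Fin m → Fin m → Fin m → ℕ) →
  ∑³ (λ i j k → ∑[ σ < n ] g σ i j k) ≡ ∑[ σ < n ] ∑³ (g σ)
∑³-∑-comm g =
  trans (sum-cong-≗ λ i → trans (sum-cong-≗ λ j → ∑-comm (λ k σ → g σ i j k)) (∑-comm (λ j σ → sum (g σ i j))))
        (∑-comm (λ i σ → ∑² (g σ i)))

∑²³-transpose : ∀ {m} (F : Fin m → Fin m → Fin m → Fin m → Fin m → Fin m → ℕ) →
  ∑² (λ a b → ∑² (λ c d → ∑² (λ e f → F a b c d e f))) ≡ ∑³ (λ a c e → ∑³ (λ b d f → F a b c d e f))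
∑²³-transpose F = begin
  ∑² (λ a b → ∑² (λ c d → ∑² (λ e f → F a b c d e f)))
    ≡⟨ sum-cong-≗ (λ a → ∑-comm (λ b c → ∑[ d < _ ] ∑² (λ e f → F a b c d e f))) ⟩
  ∑² (λ a c → ∑² (λ b d → ∑² (λ e f → F a b c d e f)))
    ≡⟨ ∑²-cong (λ a c → sum-cong-≗ λ b → ∑-comm (λ d e → ∑[ f < _ ] F a b c d e f)) ⟩
  ∑² (λ a c → ∑² (λ b e → ∑² (λ d f → F a b c d e f)))
    ≡⟨ ∑²-cong (λ a c → ∑-comm (λ b e → ∑² (λ d f → F a b c d e f))) ⟩
  ∑³ (λ a c e → ∑³ (λ b d f → F a b c d e f)) ∎

permute : ∀ {A B : Set} → Fin 6 → (A → A → A → B) → A → A → A → B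
permute 0F f i j k = f i j k
permute 1F f i j k = f i k j
permute 2F f i j k = f j i k
permute 3F f i j k = f j k i
permute 4F f i j k = f k i j
permute 5F f i j k = f k j i

Invariant³ : ∀ {A B : Set} → (A → A → A → B) → Set
Invariant³ f = ∀ σ i j k → permute σ f i j k ≡ f i j k

transpositions⇒invariant³ : ∀ {A B : Set} {f : A → A → A → B} →
  (∀ i j k → f j i k ≡ f i j k) → (∀ i j k → f i k j ≡ f i j k) → Invariant³ f
transpositions⇒invariant³ s₁₂ s₂₃ 0F i j k = refl
transpositions⇒invariant³ s₁₂ s₂₃ 1F i j k = s₂₃ i j k
transpositions⇒invariant³ s₁₂ s₂₃ 2F i j k = s₁₂ i j k
transpositions⇒invariant³ s₁₂ s₂₃ 3F i j k = trans (s₂₃ j i k) (s₁₂ i j k)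
transpositions⇒invariant³ s₁₂ s₂₃ 4F i j k = trans (s₁₂ i k j) (s₂₃ i j k)
transpositions⇒invariant³ s₁₂ s₂₃ 5F i j k = trans (s₂₃ k i j) (transpositions⇒invariant³ s₁₂ s₂₃ 4F i j k)

∑³-permute : ∀ {m} σ (f : Fin m → Fin m → Fin m → ℕ) → ∑³ (permute σ f) ≡ ∑³ f
∑³-permute 0F f = refl
∑³-permute 1F f = ∑³-swap₂₃ f
∑³-permute 2F f = ∑³-swap₁₂ f
∑³-permute 3F f = trans (∑³-swap₁₂ (λ i j k → f i k j)) (∑³-swap₂₃ f)
∑³-permute 4F f = trans (∑³-swap₂₃ (λ i j k → f j i k)) (∑³-swap₁₂ f)
∑³-permute 5F f = trans (∑³-swap₂₃ (λ i j k → f j k i)) (∑³-permute 3F f)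

Distinct : ∀ {A : Set} → A → A → A → Set
Distinct i j k = i ≢ j × j ≢ k × i ≢ k

Increasing : ∀ {m} → Fin m → Fin m → Fin m → Bool
Increasing i j k = ⌊ i <? j ⌋ ∧ ⌊ j <? k ⌋

-- x, y, z play the roles of i < j, j < k, i < k, and x′, y′, z′ of the reversed comparisons.
exactly-one-of-six : ∀ x y z {x′ y′ z′} → x′ ≡ not x → y′ ≡ not y → z′ ≡ not z →
  (T (x ∧ y) → T z) → (T z → T (x ∨ y)) →
  ⟦ x ∧ y ⟧ + (⟦ z ∧ y′ ⟧ + (⟦ x′ ∧ z ⟧ + (⟦ y ∧ z′ ⟧ + (⟦ z′ ∧ x ⟧ + (⟦ y′ ∧ x′ ⟧ + 0))))) ≡ 1
exactly-one-of-six true  true  true  refl refl refl _       _       = refl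
exactly-one-of-six true  true  false refl refl refl x∧y⇒z _       = ⊥-elim (x∧y⇒z _)
exactly-one-of-six true  false true  refl refl refl _       _       = refl
exactly-one-of-six true  false false refl refl refl _       _       = refl
exactly-one-of-six false true  true  refl refl refl _       _       = refl
exactly-one-of-six false true  false refl refl refl _       _       = refl
exactly-one-of-six false false true  refl refl refl _       z⇒x∨y = ⊥-elim (z⇒x∨y _)
exactly-one-of-six false false false refl refl refl _       _       = refl

<?-flip : ∀ {m} {i j : Fin m} → i ≢ j → ⌊ j <? i ⌋ ≡ not ⌊ i <? j ⌋
<?-flip {i = i} {j} i≢j with i <? j | j <? i
... | yes i<j | yes j<i = ⊥-elim (Fin.<-asym i<j j<i)
... | yes _   | no _    = refl
... | no _    | yes _   = refl
... | no i≮j  | no j≮i  = ⊥-elim (i≢j (Fin.≤-antisym (≮⇒≥ j≮i) (≮⇒≥ i≮j)))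

<?-trans : ∀ {m} {i j k : Fin m} → T (⌊ i <? j ⌋ ∧ ⌊ j <? k ⌋) → T ⌊ i <? k ⌋
<?-trans {i = i} {j} {k} p with ∧⁻ {⌊ i <? j ⌋} p
... | i<j , j<k = fromWitness (Fin.<-trans (toWitness {a? = i <? j} i<j) (toWitness {a? = j <? k} j<k))

<?-cotrans : ∀ {m} {i j k : Fin m} → T ⌊ i <? k ⌋ → T (⌊ i <? j ⌋ ∨ ⌊ j <? k ⌋)
<?-cotrans {i = i} {j} {k} i<k with i <? j | j <? k
... | yes _  | _      = _
... | no _   | yes _  = _
... | no i≮j | no j≮k = ⊥-elim (i≮j (<-≤-trans (toWitness {a? = i <? k} i<k) (≮⇒≥ j≮k)))

increasing-unique : ∀ {m} {i j k : Fin m} → Distinct i j k →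
  ∑[ σ < 6 ] ⟦ permute σ Increasing i j k ⟧ ≡ 1
increasing-unique (i≢j , j≢k , i≢k) =
  exactly-one-of-six _ _ _ (<?-flip i≢j) (<?-flip j≢k) (<?-flip i≢k) <?-trans <?-cotrans

n≡w*n : ∀ w n → (n ≢ 0 → w ≡ 1) → n ≡ w * n
n≡w*n w zero    _   = sym (*-zeroʳ w)
n≡w*n w (suc n) w≡1 rewrite w≡1 (λ ()) = sym (*-identityˡ (suc n))

∑³-invariant≡6*increasing : ∀ {m} (f : Fin m → Fin m → Fin m → ℕ) → Invariant³ f →
  (∀ {i j k} → f i j k ≢ 0 → Distinct i j k) →
  ∑³ f ≡ 6 * ∑³ (λ i j k → ⟦ Increasing i j k ⟧ * f i j k)
∑³-invariant≡6*increasing f invariant supported = begin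
  ∑³ f                                         ≡⟨ ∑³-cong orbit-sum ⟩
  ∑³ (λ i j k → ∑[ σ < 6 ] permute σ g i j k) ≡⟨ ∑³-∑-comm (λ σ → permute σ g) ⟩
  ∑[ σ < 6 ] ∑³ (permute σ g)                 ≡⟨ sum-cong-≗ (λ σ → ∑³-permute σ g) ⟩
  ∑[ σ < 6 ] ∑³ g                             ≡⟨ sum-replicate 6 {∑³ g} ⟩
  6 * ∑³ g                                     ∎
  where
  g : _ → _ → _ → ℕ
  g i j k = ⟦ Increasing i j k ⟧ * f i j k

  orbit-sum : ∀ i j k → f i j k ≡ ∑[ σ < 6 ] permute σ g i j k
  orbit-sum i j k = begin
    f i j k
      ≡⟨ n≡w*n _ (f i j k) (increasing-unique ∘ supported) ⟩
    (∑[ σ < 6 ] ⟦ permute σ Increasing i j k ⟧) * f i j k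
      ≡⟨ *-distribʳ-sum (f i j k) (λ σ → ⟦ permute σ Increasing i j k ⟧) ⟩
    ∑[ σ < 6 ] (⟦ permute σ Increasing i j k ⟧ * f i j k)
      ≡⟨ sum-cong-≗ (λ σ → cong (⟦ permute σ Increasing i j k ⟧ *_) (sym (invariant σ i j k))) ⟩
    ∑[ σ < 6 ] permute σ g i j k ∎

IsTriangle : ∀ {A : Set} → (A → A → Bool) → A → A → A → Bool
IsTriangle R x y z = R x y ∧ (R y z ∧ R x z)

triangle-edges : ∀ {A : Set} (R : A → A → Bool) {x y z} → T (IsTriangle R x y z) →
  T (R x y) × T (R y z) × T (R x z)
triangle-edges R {x} {y} {z} t = let xy , t′ = ∧⁻ {R x y} t in xy , ∧⁻ {R y z} t′

triangle-intro : ∀ {A : Set} (R : A → A → Bool) {x y z} → T (R x y) → T (R y z) → T (R x z) →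
  T (IsTriangle R x y z)
triangle-intro R {x} {y} {z} xy yz xz = ∧⁺ {R x y} xy (∧⁺ {R y z} yz xz)

module _ {A : Set} {R : A → A → Bool} (R-sym : ∀ x y → R x y ≡ R y x) where

  IsTriangle-swap₁₂ : ∀ x y z → IsTriangle R y x z ≡ IsTriangle R x y z
  IsTriangle-swap₁₂ x y z = cong₂ _∧_ (R-sym y x) (∧-comm (R x z) (R y z))

  IsTriangle-swap₂₃ : ∀ x y z → IsTriangle R x z y ≡ IsTriangle R x y z
  IsTriangle-swap₂₃ x y z = begin
    R x z ∧ (R z y ∧ R x y) ≡⟨ cong (λ b → R x z ∧ (b ∧ R x y)) (R-sym z y) ⟩
    R x z ∧ (R y z ∧ R x y) ≡⟨ ∧-comm (R x z) _ ⟩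
    (R y z ∧ R x y) ∧ R x z ≡⟨ cong (_∧ R x z) (∧-comm (R y z) (R x y)) ⟩
    (R x y ∧ R y z) ∧ R x z ≡⟨ ∧-assoc (R x y) (R y z) (R x z) ⟩
    R x y ∧ (R y z ∧ R x z) ∎

  ⟦IsTriangle⟧-invariant : Invariant³ (λ x y z → ⟦ IsTriangle R x y z ⟧)
  ⟦IsTriangle⟧-invariant = transpositions⇒invariant³
    (λ x y z → cong ⟦_⟧ (IsTriangle-swap₁₂ x y z)) (λ x y z → cong ⟦_⟧ (IsTriangle-swap₂₃ x y z))

orderedTriangles : Graph → ℕ
orderedTriangles X = ∑³ λ i j k → ⟦ IsTriangle (adj X) i j k ⟧

=ᶠ-sym : ∀ {m} (u v : Fin m) → (u =ᶠ v) ≡ (v =ᶠ u)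
=ᶠ-sym u v with u ≟ v | v ≟ u
... | yes _   | yes _   = refl
... | no _    | no _    = refl
... | yes u≡v | no v≢u  = ⊥-elim (v≢u (sym u≡v))
... | no u≢v  | yes v≡u = ⊥-elim (u≢v (sym v≡u))

γadj-sym : ∀ {m} (D E : Fin m × Fin m) → γadj D E ≡ γadj E D
γadj-sym (u , v) (x , y) rewrite =ᶠ-sym x v | =ᶠ-sym u y = ∨-comm ((v =ᶠ x) ∧ not (y =ᶠ u)) _

γadj-irrefl : ∀ {m} (D : Fin m × Fin m) → γadj D D ≡ false
γadj-irrefl (u , v) rewrite =ᶠ-sym u v | ∧-inverseʳ (v =ᶠ u) = refl

γ-simple : (X : Graph) → IsSimple (γ X)
γ-simple X = (λ i j → γadj-sym (lookup (darts X) i) (lookup (darts X) j)) , (λ i → γadj-irrefl (lookup (darts X) i))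

γ^-simple : ∀ {X} k → IsSimple X → IsSimple (γ^ k X)
γ^-simple     zero    simple = simple
γ^-simple {X} (suc k) simple = γ-simple (γ^ k X)

γadj⇒meet : ∀ {m} {u v x y : Fin m} → T (γadj (u , v) (x , y)) → v ≡ x ⊎ y ≡ u
γadj⇒meet {u = u} {v} {x} {y} e =
  Sum.map (toWitness ∘ proj₁ ∘ ∧⁻ {v =ᶠ x}) (toWitness ∘ proj₁ ∘ ∧⁻ {y =ᶠ u})
          (Equivalence.to (T-∨ {(v =ᶠ x) ∧ not (y =ᶠ u)}) e)

consecutive⇒γadj : ∀ {m} {u v w : Fin m} → w ≢ u → T (γadj (u , v) (v , w))
consecutive⇒γadj {v = v} w≢u =
  Equivalence.from T-∨ (inj₁ (∧⁺ (fromWitness {a? = v ≟ v} refl) (fromWitnessFalse w≢u)))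

module _ (X : Graph) where

  private
    V    = Fin (n X)
    Dart = V × V

  ∑-darts : (h : Dart → ℕ) →
    ∑[ i < length (darts X) ] h (lookup (darts X) i) ≡ ∑² (λ u v → ⟦ adj X u v ⟧ * h (u , v))
  ∑-darts h = begin
    ∑[ i < length (darts X) ] h (lookup (darts X) i)
      ≡⟨ ∑-lookup (darts X) h ⟩
    sumˡ (map h (darts X))
      ≡⟨ sumˡ-concatMap h (λ u → concatMap (arcs u) (allFin (n X))) (allFin (n X)) ⟩
    Σᶠ (λ u → sumˡ (map h (concatMap (arcs u) (allFin (n X)))))
      ≡⟨ Σᶠ≡sum (λ u → sumˡ (map h (concatMap (arcs u) (allFin (n X))))) ⟩
    ∑[ u < n X ] sumˡ (map h (concatMap (arcs u) (allFin (n X))))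
      ≡⟨ sum-cong-≗ (λ u → trans (sumˡ-concatMap h (arcs u) (allFin (n X))) (Σᶠ≡sum λ v → sumˡ (map h (arcs u v)))) ⟩
    ∑² (λ u v → sumˡ (map h (arcs u v)))
      ≡⟨ ∑²-cong sumˡ-arcs ⟩
    ∑² (λ u v → ⟦ adj X u v ⟧ * h (u , v)) ∎
    where
    arcs : V → V → List Dart
    arcs u v = if adj X u v then (u , v) ∷ [] else []

    sumˡ-arcs : ∀ u v → sumˡ (map h (arcs u v)) ≡ ⟦ adj X u v ⟧ * h (u , v)
    sumˡ-arcs u v with adj X u v
    ... | true  = refl
    ... | false = refl

  ∑³-darts : (g : Dart → Dart → Dart → ℕ) →
    ∑³ (λ i j k → g (lookup (darts X) i) (lookup (darts X) j) (lookup (darts X) k)) ≡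
    ∑³ (λ u₁ u₂ u₃ → ∑³ (λ v₁ v₂ v₃ →
      ⟦ adj X u₁ v₁ ⟧ * (⟦ adj X u₂ v₂ ⟧ * (⟦ adj X u₃ v₃ ⟧ * g (u₁ , v₁) (u₂ , v₂) (u₃ , v₃)))))
  ∑³-darts g = begin
    ∑³ (λ i j k → g (L i) (L j) (L k))
      ≡⟨ sum-cong-≗ (λ i → sum-cong-≗ λ j → ∑-darts (g (L i) (L j))) ⟩
    ∑[ i < _ ] ∑[ j < _ ] ∑² (λ u₃ v₃ → w u₃ v₃ * g (L i) (L j) (u₃ , v₃))
      ≡⟨ sum-cong-≗ (λ i → ∑-darts λ E → ∑² λ u₃ v₃ → w u₃ v₃ * g (L i) E (u₃ , v₃)) ⟩
    ∑[ i < _ ] ∑² (λ u₂ v₂ → w u₂ v₂ * ∑² (λ u₃ v₃ → w u₃ v₃ * g (L i) (u₂ , v₂) (u₃ , v₃)))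
      ≡⟨ ∑-darts (λ D → ∑² λ u₂ v₂ → w u₂ v₂ * ∑² (λ u₃ v₃ → w u₃ v₃ * g D (u₂ , v₂) (u₃ , v₃))) ⟩
    ∑² (λ u₁ v₁ → w u₁ v₁ * ∑² (λ u₂ v₂ → w u₂ v₂ * ∑² (λ u₃ v₃ → w u₃ v₃ * G u₁ v₁ u₂ v₂ u₃ v₃)))
      ≡⟨ ∑²-cong distribute ⟩
    ∑² (λ u₁ v₁ → ∑² (λ u₂ v₂ → ∑² (λ u₃ v₃ → w u₁ v₁ * (w u₂ v₂ * (w u₃ v₃ * G u₁ v₁ u₂ v₂ u₃ v₃)))))
      ≡⟨ ∑²³-transpose (λ u₁ v₁ u₂ v₂ u₃ v₃ → w u₁ v₁ * (w u₂ v₂ * (w u₃ v₃ * G u₁ v₁ u₂ v₂ u₃ v₃))) ⟩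
    ∑³ (λ u₁ u₂ u₃ → ∑³ (λ v₁ v₂ v₃ → w u₁ v₁ * (w u₂ v₂ * (w u₃ v₃ * G u₁ v₁ u₂ v₂ u₃ v₃)))) ∎
    where
    L : Fin (length (darts X)) → Dart
    L = lookup (darts X)

    w : V → V → ℕ
    w u v = ⟦ adj X u v ⟧

    G : V → V → V → V → V → V → ℕ
    G u₁ v₁ u₂ v₂ u₃ v₃ = g (u₁ , v₁) (u₂ , v₂) (u₃ , v₃)

    distribute : ∀ u₁ v₁ →
      w u₁ v₁ * ∑² (λ u₂ v₂ → w u₂ v₂ * ∑² (λ u₃ v₃ → w u₃ v₃ * G u₁ v₁ u₂ v₂ u₃ v₃)) ≡
      ∑² (λ u₂ v₂ → ∑² (λ u₃ v₃ → w u₁ v₁ * (w u₂ v₂ * (w u₃ v₃ * G u₁ v₁ u₂ v₂ u₃ v₃))))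
    distribute u₁ v₁ = begin
      w u₁ v₁ * ∑² (λ u₂ v₂ → w u₂ v₂ * ∑² (λ u₃ v₃ → w u₃ v₃ * G u₁ v₁ u₂ v₂ u₃ v₃))
        ≡⟨ cong (w u₁ v₁ *_) (∑²-cong λ u₂ v₂ → *-distribˡ-∑² (w u₂ v₂) (λ u₃ v₃ → w u₃ v₃ * G u₁ v₁ u₂ v₂ u₃ v₃)) ⟩
      w u₁ v₁ * ∑² (λ u₂ v₂ → ∑² (λ u₃ v₃ → w u₂ v₂ * (w u₃ v₃ * G u₁ v₁ u₂ v₂ u₃ v₃)))
        ≡⟨ *-distribˡ-∑² (w u₁ v₁) (λ u₂ v₂ → ∑² (λ u₃ v₃ → w u₂ v₂ * (w u₃ v₃ * G u₁ v₁ u₂ v₂ u₃ v₃))) ⟩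
      ∑² (λ u₂ v₂ → w u₁ v₁ * ∑² (λ u₃ v₃ → w u₂ v₂ * (w u₃ v₃ * G u₁ v₁ u₂ v₂ u₃ v₃)))
        ≡⟨ ∑²-cong (λ u₂ v₂ → *-distribˡ-∑² (w u₁ v₁) (λ u₃ v₃ → w u₂ v₂ * (w u₃ v₃ * G u₁ v₁ u₂ v₂ u₃ v₃))) ⟩
      ∑² (λ u₂ v₂ → ∑² (λ u₃ v₃ → w u₁ v₁ * (w u₂ v₂ * (w u₃ v₃ * G u₁ v₁ u₂ v₂ u₃ v₃)))) ∎

  ArcTriangle : Dart → Dart → Dart → Bool
  ArcTriangle (u₁ , v₁) (u₂ , v₂) (u₃ , v₃) =
    adj X u₁ v₁ ∧ (adj X u₂ v₂ ∧ (adj X u₃ v₃ ∧ IsTriangle γadj (u₁ , v₁) (u₂ , v₂) (u₃ , v₃)))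

  DirectedTriangle : Dart → Dart → Dart → Bool
  DirectedTriangle (u₁ , v₁) (u₂ , v₂) (u₃ , v₃) =
    (v₃ =ᶠ u₁) ∧ ((v₂ =ᶠ u₃) ∧ ((v₁ =ᶠ u₂) ∧ IsTriangle (adj X) u₁ u₂ u₃))

  arcTriangle-parts : ∀ {u₁ v₁ u₂ v₂ u₃ v₃} → T (ArcTriangle (u₁ , v₁) (u₂ , v₂) (u₃ , v₃)) →
    T (adj X u₁ v₁) × T (adj X u₂ v₂) × T (adj X u₃ v₃) × T (IsTriangle γadj (u₁ , v₁) (u₂ , v₂) (u₃ , v₃))
  arcTriangle-parts {u₁} {v₁} {u₂} {v₂} {u₃} {v₃} p =
    let a₁ , p′ = ∧⁻ {adj X u₁ v₁} p
        a₂ , p″ = ∧⁻ {adj X u₂ v₂} p′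
    in a₁ , a₂ , ∧⁻ {adj X u₃ v₃} p″

  arcTriangle-intro : ∀ {u₁ v₁ u₂ v₂ u₃ v₃} → T (adj X u₁ v₁) → T (adj X u₂ v₂) → T (adj X u₃ v₃) →
    T (IsTriangle γadj (u₁ , v₁) (u₂ , v₂) (u₃ , v₃)) → T (ArcTriangle (u₁ , v₁) (u₂ , v₂) (u₃ , v₃))
  arcTriangle-intro {u₁} {v₁} {u₂} {v₂} {u₃} {v₃} a₁ a₂ a₃ t =
    ∧⁺ {adj X u₁ v₁} a₁ (∧⁺ {adj X u₂ v₂} a₂ (∧⁺ {adj X u₃ v₃} a₃ t))

  directed-parts : ∀ {u₁ v₁ u₂ v₂ u₃ v₃} → T (DirectedTriangle (u₁ , v₁) (u₂ , v₂) (u₃ , v₃)) →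
    v₃ ≡ u₁ × v₂ ≡ u₃ × v₁ ≡ u₂ × T (IsTriangle (adj X) u₁ u₂ u₃)
  directed-parts {u₁} {v₁} {u₂} {v₂} {u₃} {v₃} d =
    let v₃≡u₁ , d′ = ∧⁻ d
        v₂≡u₃ , d″ = ∧⁻ d′
        v₁≡u₂ , t  = ∧⁻ d″
    in toWitness {a? = v₃ ≟ u₁} v₃≡u₁ , toWitness {a? = v₂ ≟ u₃} v₂≡u₃ , toWitness {a? = v₁ ≟ u₂} v₁≡u₂ , t

  ∑-directed : ∀ u₁ u₂ u₃ →
    ∑³ (λ v₁ v₂ v₃ → ⟦ DirectedTriangle (u₁ , v₁) (u₂ , v₂) (u₃ , v₃) ⟧) ≡ ⟦ IsTriangle (adj X) u₁ u₂ u₃ ⟧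
  ∑-directed u₁ u₂ u₃ = begin
    ∑³ (λ v₁ v₂ v₃ → ⟦ (v₃ =ᶠ u₁) ∧ ((v₂ =ᶠ u₃) ∧ ((v₁ =ᶠ u₂) ∧ t)) ⟧)
      ≡⟨ ∑²-cong (λ v₁ v₂ → ∑-δ u₁ ((v₂ =ᶠ u₃) ∧ ((v₁ =ᶠ u₂) ∧ t))) ⟩
    ∑² (λ v₁ v₂ → ⟦ (v₂ =ᶠ u₃) ∧ ((v₁ =ᶠ u₂) ∧ t) ⟧)
      ≡⟨ sum-cong-≗ (λ v₁ → ∑-δ u₃ ((v₁ =ᶠ u₂) ∧ t)) ⟩
    ∑[ v₁ < n X ] ⟦ (v₁ =ᶠ u₂) ∧ t ⟧
      ≡⟨ ∑-δ u₂ t ⟩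
    ⟦ t ⟧ ∎
    where t = IsTriangle (adj X) u₁ u₂ u₃

module _ {X : Graph} (simple : IsSimple X) where

  adj-sym : ∀ u v → adj X u v ≡ adj X v u
  adj-sym = proj₁ simple

  adj-irrefl : ∀ {u v} → T (adj X u v) → u ≢ v
  adj-irrefl {u} uv refl = subst T (proj₂ simple u) uv

  triangle-distinct : ∀ {i j k} → T (IsTriangle (adj X) i j k) → Distinct i j k
  triangle-distinct t =
    let ij , jk , ik = triangle-edges (adj X) t in adj-irrefl ij , adj-irrefl jk , adj-irrefl ik

  orderedTriangles≡6*triangles : orderedTriangles X ≡ 6 * triangles X
  orderedTriangles≡6*triangles = begin
    orderedTriangles X
      ≡⟨ ∑³-invariant≡6*increasing (λ i j k → ⟦ Tri i j k ⟧)
           (⟦IsTriangle⟧-invariant adj-sym) (triangle-distinct ∘ ⟦⟧≢0⇒T) ⟩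
    6 * ∑³ (λ i j k → ⟦ Increasing i j k ⟧ * ⟦ Tri i j k ⟧)
      ≡⟨ cong (6 *_) (∑³-cong λ i j k → sym (⟦∧∧⟧ (⌊ i <? j ⌋) (⌊ j <? k ⌋) (Tri i j k))) ⟩
    6 * ∑³ (λ i j k → ⟦ ⌊ i <? j ⌋ ∧ (⌊ j <? k ⌋ ∧ Tri i j k) ⟧)
      ≡⟨ cong (6 *_) (sym (Σᶠ³≡∑³ λ i j k → ⟦ ⌊ i <? j ⌋ ∧ (⌊ j <? k ⌋ ∧ Tri i j k) ⟧)) ⟩
    6 * triangles X ∎
    where
    Tri = IsTriangle (adj X)

    ⟦∧∧⟧ : ∀ x y z → ⟦ x ∧ (y ∧ z) ⟧ ≡ ⟦ x ∧ y ⟧ * ⟦ z ⟧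
    ⟦∧∧⟧ x y z = trans (cong ⟦_⟧ (sym (∧-assoc x y z))) (⟦∧⟧ (x ∧ y) z)

  meets⇒cycle : ∀ {u₁ v₁ u₂ v₂ u₃ v₃} → T (adj X u₁ v₁) → T (adj X u₂ v₂) → T (adj X u₃ v₃) →
    v₁ ≡ u₂ ⊎ v₂ ≡ u₁ → v₂ ≡ u₃ ⊎ v₃ ≡ u₂ → v₁ ≡ u₃ ⊎ v₃ ≡ u₁ →
    (v₃ ≡ u₁ × v₂ ≡ u₃ × v₁ ≡ u₂) ⊎ (v₂ ≡ u₁ × v₃ ≡ u₂ × v₁ ≡ u₃)
  meets⇒cycle a₁ a₂ a₃ (inj₁ refl) (inj₁ refl) (inj₁ r)    = ⊥-elim (adj-irrefl a₂ r)
  meets⇒cycle a₁ a₂ a₃ (inj₁ refl) (inj₁ refl) (inj₂ refl) = inj₁ (refl , refl , refl)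
  meets⇒cycle a₁ a₂ a₃ (inj₁ refl) (inj₂ refl) (inj₁ r)    = ⊥-elim (adj-irrefl a₃ (sym r))
  meets⇒cycle a₁ a₂ a₃ (inj₁ refl) (inj₂ refl) (inj₂ r)    = ⊥-elim (adj-irrefl a₁ (sym r))
  meets⇒cycle a₁ a₂ a₃ (inj₂ refl) (inj₁ q)    (inj₁ refl) = ⊥-elim (adj-irrefl a₁ q)
  meets⇒cycle a₁ a₂ a₃ (inj₂ refl) (inj₁ q)    (inj₂ refl) = ⊥-elim (adj-irrefl a₃ (sym q))
  meets⇒cycle a₁ a₂ a₃ (inj₂ refl) (inj₂ refl) (inj₁ refl) = inj₂ (refl , refl , refl)
  meets⇒cycle a₁ a₂ a₃ (inj₂ refl) (inj₂ refl) (inj₂ r)    = ⊥-elim (adj-irrefl a₂ r)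

  cycle⇒directed : ∀ {u₁ v₁ u₂ v₂ u₃ v₃} → T (adj X u₁ v₁) → T (adj X u₂ v₂) → T (adj X u₃ v₃) →
    v₃ ≡ u₁ → v₂ ≡ u₃ → v₁ ≡ u₂ → T (DirectedTriangle X (u₁ , v₁) (u₂ , v₂) (u₃ , v₃))
  cycle⇒directed {u₁} {u₂ = u₂} {u₃ = u₃} a₁₂ a₂₃ a₃₁ refl refl refl =
    ∧⁺ (fromWitness {a? = u₁ ≟ u₁} refl) (∧⁺ (fromWitness {a? = u₃ ≟ u₃} refl) (∧⁺ (fromWitness {a? = u₂ ≟ u₂} refl)
      (triangle-intro (adj X) a₁₂ a₂₃ (subst T (adj-sym u₃ u₁) a₃₁))))

  cycle⇒arcTriangle : ∀ {u₁ u₂ u₃} → T (IsTriangle (adj X) u₁ u₂ u₃) →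
    T (ArcTriangle X (u₁ , u₂) (u₂ , u₃) (u₃ , u₁))
  cycle⇒arcTriangle {u₁} {u₂} {u₃} t =
    let a₁₂ , a₂₃ , a₁₃ = triangle-edges (adj X) t
    in arcTriangle-intro X a₁₂ a₂₃ (subst T (adj-sym u₁ u₃) a₁₃)
         (triangle-intro γadj {u₁ , u₂} {u₂ , u₃} {u₃ , u₁}
            (consecutive⇒γadj (adj-irrefl a₁₃ ∘ sym))
            (consecutive⇒γadj (adj-irrefl a₁₂))
            (subst T (γadj-sym (u₃ , u₁) (u₁ , u₂)) (consecutive⇒γadj (adj-irrefl a₂₃))))

  arcTriangle⇒directed : ∀ D E F → T (ArcTriangle X D E F) →
    T (DirectedTriangle X D E F) ⊎ T (DirectedTriangle X D F E)
  arcTriangle⇒directed (u₁ , v₁) (u₂ , v₂) (u₃ , v₃) p =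
    let a₁ , a₂ , a₃ , t    = arcTriangle-parts X {u₁} {v₁} {u₂} {v₂} {u₃} {v₃} p
        γ₁₂ , γ₂₃ , γ₁₃ = triangle-edges γadj {u₁ , v₁} {u₂ , v₂} {u₃ , v₃} t
    in Sum.map (λ (p , q , r) → cycle⇒directed a₁ a₂ a₃ p q r) (λ (p , q , r) → cycle⇒directed a₁ a₃ a₂ p q r)
               (meets⇒cycle a₁ a₂ a₃ (γadj⇒meet γ₁₂) (γadj⇒meet γ₂₃) (γadj⇒meet γ₁₃))

  directed⇒arcTriangle : ∀ D E F → T (DirectedTriangle X D E F) → T (ArcTriangle X D E F)
  directed⇒arcTriangle (u₁ , v₁) (u₂ , v₂) (u₃ , v₃) d with directed-parts X {u₁} {v₁} {u₂} {v₂} {u₃} {v₃} d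
  ... | refl , refl , refl , t = cycle⇒arcTriangle t

  arcTriangle-swap : ∀ D E F → T (ArcTriangle X D F E) → T (ArcTriangle X D E F)
  arcTriangle-swap D@(u₁ , v₁) E@(u₂ , v₂) F@(u₃ , v₃) p =
    let a₁ , a₃ , a₂ , t = arcTriangle-parts X {u₁} {v₁} {u₃} {v₃} {u₂} {v₂} p
    in arcTriangle-intro X a₁ a₂ a₃ (subst T (IsTriangle-swap₂₃ γadj-sym D E F) t)

  directed-disjoint : ∀ D E F → T (DirectedTriangle X D E F) → ¬ T (DirectedTriangle X D F E)
  directed-disjoint (u₁ , v₁) (u₂ , v₂) (u₃ , v₃) d d′
    with directed-parts X {u₁} {v₁} {u₂} {v₂} {u₃} {v₃} d | directed-parts X {u₁} {v₁} {u₃} {v₃} {u₂} {v₂} d′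
  ... | _ , _ , v₁≡u₂ , t | _ , _ , v₁≡u₃ , _ =
    adj-irrefl (proj₁ (proj₂ (triangle-edges (adj X) t))) (trans (sym v₁≡u₂) v₁≡u₃)

  ⟦ArcTriangle⟧ : ∀ D E F → ⟦ ArcTriangle X D E F ⟧ ≡ ⟦ DirectedTriangle X D E F ⟧ + ⟦ DirectedTriangle X D F E ⟧
  ⟦ArcTriangle⟧ D E F = ⟦⟧-partition (arcTriangle⇒directed D E F) (directed⇒arcTriangle D E F)
    (arcTriangle-swap D E F ∘ directed⇒arcTriangle D F E) (directed-disjoint D E F)

  ∑-heads : ∀ u₁ u₂ u₃ →
    ∑³ (λ v₁ v₂ v₃ → ⟦ adj X u₁ v₁ ⟧ * (⟦ adj X u₂ v₂ ⟧ * (⟦ adj X u₃ v₃ ⟧ * ⟦ IsTriangle γadj (u₁ , v₁) (u₂ , v₂) (u₃ , v₃) ⟧))) ≡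
    2 * ⟦ IsTriangle (adj X) u₁ u₂ u₃ ⟧
  ∑-heads u₁ u₂ u₃ = begin
    ∑³ (λ v₁ v₂ v₃ → ⟦ adj X u₁ v₁ ⟧ * (⟦ adj X u₂ v₂ ⟧ * (⟦ adj X u₃ v₃ ⟧ * ⟦ IsTriangle γadj (D v₁) (E v₂) (F v₃) ⟧)))
      ≡⟨ ∑³-cong (λ v₁ v₂ v₃ → sym (⟦∧⟧³ (adj X u₁ v₁) (adj X u₂ v₂) (adj X u₃ v₃) (IsTriangle γadj (D v₁) (E v₂) (F v₃)))) ⟩
    ∑³ (λ v₁ v₂ v₃ → ⟦ ArcTriangle X (D v₁) (E v₂) (F v₃) ⟧)
      ≡⟨ ∑³-cong (λ v₁ v₂ v₃ → ⟦ArcTriangle⟧ (D v₁) (E v₂) (F v₃)) ⟩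
    ∑³ (λ v₁ v₂ v₃ → ⟦ DirectedTriangle X (D v₁) (E v₂) (F v₃) ⟧ + ⟦ DirectedTriangle X (D v₁) (F v₃) (E v₂) ⟧)
      ≡⟨ ∑³-distrib-+ (λ v₁ v₂ v₃ → ⟦ DirectedTriangle X (D v₁) (E v₂) (F v₃) ⟧)
                      (λ v₁ v₂ v₃ → ⟦ DirectedTriangle X (D v₁) (F v₃) (E v₂) ⟧) ⟩
    ∑³ (λ v₁ v₂ v₃ → ⟦ DirectedTriangle X (D v₁) (E v₂) (F v₃) ⟧) + ∑³ (λ v₁ v₂ v₃ → ⟦ DirectedTriangle X (D v₁) (F v₃) (E v₂) ⟧)
      ≡⟨ cong₂ _+_ (∑-directed X u₁ u₂ u₃)
                   (trans (∑³-swap₂₃ λ v₁ v₃ v₂ → ⟦ DirectedTriangle X (D v₁) (F v₃) (E v₂) ⟧) (∑-directed X u₁ u₃ u₂)) ⟩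
    ⟦ Tri u₁ u₂ u₃ ⟧ + ⟦ Tri u₁ u₃ u₂ ⟧
      ≡⟨ cong (⟦ Tri u₁ u₂ u₃ ⟧ +_) (trans (cong ⟦_⟧ (IsTriangle-swap₂₃ adj-sym u₁ u₂ u₃)) (sym (+-identityʳ _))) ⟩
    2 * ⟦ Tri u₁ u₂ u₃ ⟧ ∎
    where
    Tri = IsTriangle (adj X)

    D E F : Fin (n X) → Fin (n X) × Fin (n X)
    D v = u₁ , v
    E v = u₂ , v
    F v = u₃ , v

    ⟦∧⟧³ : ∀ x y z w → ⟦ x ∧ (y ∧ (z ∧ w)) ⟧ ≡ ⟦ x ⟧ * (⟦ y ⟧ * (⟦ z ⟧ * ⟦ w ⟧))
    ⟦∧⟧³ x y z w = trans (⟦∧⟧ x _) (cong (⟦ x ⟧ *_) (trans (⟦∧⟧ y _) (cong (⟦ y ⟧ *_) (⟦∧⟧ z w))))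

  orderedTriangles-γ : orderedTriangles (γ X) ≡ 2 * orderedTriangles X
  orderedTriangles-γ = begin
    orderedTriangles (γ X)
      ≡⟨ ∑³-darts X (λ D E F → ⟦ IsTriangle γadj D E F ⟧) ⟩
    ∑³ (λ u₁ u₂ u₃ → ∑³ (λ v₁ v₂ v₃ →
      ⟦ adj X u₁ v₁ ⟧ * (⟦ adj X u₂ v₂ ⟧ * (⟦ adj X u₃ v₃ ⟧ * ⟦ IsTriangle γadj (u₁ , v₁) (u₂ , v₂) (u₃ , v₃) ⟧))))
      ≡⟨ ∑³-cong ∑-heads ⟩
    ∑³ (λ u₁ u₂ u₃ → 2 * ⟦ IsTriangle (adj X) u₁ u₂ u₃ ⟧)
      ≡⟨ sym (*-distribˡ-∑³ 2 (λ u₁ u₂ u₃ → ⟦ IsTriangle (adj X) u₁ u₂ u₃ ⟧)) ⟩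
    2 * orderedTriangles X ∎

triangles-γ : ∀ {X} → IsSimple X → triangles (γ X) ≡ 2 * triangles X
triangles-γ {X} simple = *-cancelˡ-≡ (triangles (γ X)) (2 * triangles X) 6 (begin
  6 * triangles (γ X)    ≡⟨ sym (orderedTriangles≡6*triangles (γ-simple X)) ⟩
  orderedTriangles (γ X) ≡⟨ orderedTriangles-γ simple ⟩
  2 * orderedTriangles X ≡⟨ cong (2 *_) (orderedTriangles≡6*triangles simple) ⟩
  2 * (6 * triangles X)  ≡⟨ x∙yz≈y∙xz *-commutativeSemigroup 2 6 (triangles X) ⟩
  6 * (2 * triangles X)  ∎)

proposition2p6 : (X : Graph) → IsSimple X →
    (k : ℕ) → triangles (γ^ k X) ≡ 2 ^ k * triangles X
proposition2p6 X simple zero    = sym (*-identityˡ (triangles X))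
proposition2p6 X simple (suc k) = begin
  triangles (γ (γ^ k X))    ≡⟨ triangles-γ (γ^-simple k simple) ⟩
  2 * triangles (γ^ k X)    ≡⟨ cong (2 *_) (proposition2p6 X simple k) ⟩
  2 * (2 ^ k * triangles X) ≡⟨ sym (*-assoc 2 (2 ^ k) (triangles X)) ⟩
  2 ^ suc k * triangles X   ∎
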